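{- Let $\phi$ be a closed trace formula of the restricted grammar and $\mathsf{can}(\phi)=\langle S_\phi,T_\phi\rangle$. Then $\mathcal{S}_{tr}[\![S_\phi]\!]$ (computed relative to the procedure table $T_\phi$) is stutter-equivalent to $[\![\phi]\!]$, i.e. $\widetilde{\mathcal{S}_{tr}[\![S_\phi]\!]}=\widetilde{[\![\phi]\!]}$.
   Context: $\mathbf{State}$ = maps from program variables to $\mathbb{Z}$; $\mathbf{State}^+$ = nonempty finite state sequences. $\mathrm{Rec}^\ast$ statements: $S ::= \mathbf{skip} \mid x := a \mid S_1;S_2 \mid \mathbf{if}\ b\ \mathbf{then}\ S_1\ \mathbf{else}\ S_2 \mid \mathbf{if}\ \ast\ \mathbf{then}\ S_1\ \mathbf{else}\ S_2 \mid m()$, relative to a table of declarations $m\,\{S_m\}$. Trace semantics: with $A|_b=\{s\cdot\sigma\in A:\mathcal{B}[\![b]\!](s)=\mathbf{tt}\}$, $\sharp A=\{s\cdot s\cdot\sigma:s\cdot\sigma\in A\}$, $A\frown B=\{\sigma_A\cdot s\cdot\sigma_B:\sigma_A\cdot s\in A,s\cdot\sigma_B\in B\}$: $\mathcal{S}_{tr}[\![\mathbf{skip}]\!]_\rho=\{s\cdot s\}$, $\mathcal{S}_{tr}[\![x:=a]\!]_\rho=\{s\cdot s[x\mapsto\mathcal{A}[\![a]\!](s)]\}$, sequencing is $\frown$, $\mathcal{S}_{tr}[\![\mathbf{if}\ b\ \mathbf{then}\ S_1\ \mathbf{else}\ S_2]\!]_\rho=(\sharp\mathcal{S}_{tr}[\![S_1]\!]_\rho)|_b\cup(\sharp\mathcal{S}_{tr}[\![S_2]\!]_\rho)|_{\neg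 b}$, $\mathcal{S}_{tr}[\![\mathbf{if}\ \ast\ \mathbf{then}\ S_1\ \mathbf{else}\ S_2]\!]_\rho=\sharp\mathcal{S}_{tr}[\![S_1]\!]_\rho\cup\sharp\mathcal{S}_{tr}[\![S_2]\!]_\rho$, $\mathcal{S}_{tr}[\![m()]\!]_\rho=\rho(m)$; $\rho_0$ is the least fixed point of $\rho\mapsto(\sharp\mathcal{S}_{tr}[\![S_m]\!]_\rho)_m$ and $\mathcal{S}_{tr}[\![S]\!]=\mathcal{S}_{tr}[\![S]\!]_{\rho_0}$. Restricted trace formulas: $\phi ::= \mathit{Id} \mid \mathit{Sb}^a_x \mid X \mid p\wedge\phi \mid \phi\vee\psi \mid \phi\frown\psi \mid \mu X.\phi$ ($p$ a Boolean expression/state formula, all recursion variables uniquely named), with $[\![\mathit{Id}]\!]=\{s\cdot s\}$, $[\![\mathit{Sb}^a_x]\!]=\{s\cdot s[x\mapsto\mathcal{A}[\![a]\!](s)]\}$, $[\![X]\!]_{\mathcal{V}}=\mathcal{V}(X)$, $[\![p\wedge\phi]\!]=\{s\cdot\sigma:s\models p\}\cap[\![\phi]\!]$, $\vee$ as union, $\frown$ as chop, $[\![\mu X.\phi]\!]_{\mathcal{V}}=\bigcap\{\gamma:[\![\phi]\!]_{\mathcal{V}[X\mapsto\gamma]}\subseteq\gamma\}$. Canonical program $\mathsf{can}(\phi)=\langle S_\phi,T_\phi\rangle$: $\mathsf{can}(\mathit{Id})=\langle\mathbf{skip},\epsilon\rangle$; $\mathsf{can}(\mathit{Sb}^a_x)=\langle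 x:=a,\epsilon\rangle$; $\mathsf{can}(p\wedge\phi)=\langle\mathbf{if}\ p\ \mathbf{then}\ S_\phi\ \mathbf{else}\ \mathbf{diverge},T_\phi\rangle$; $\mathsf{can}(\phi\vee\psi)=\langle\mathbf{if}\ \ast\ \mathbf{then}\ S_\phi\ \mathbf{else}\ S_\psi,T_\phi\,T_\psi\rangle$; $\mathsf{can}(\phi\frown\psi)=\langle S_\phi;S_\psi,T_\phi\,T_\psi\rangle$; $\mathsf{can}(\mu X.\phi)=\langle m_X(),T_\phi\,\{m_X\,\{S_\phi\}\}\rangle$; $\mathsf{can}(X)=\langle m_X(),\epsilon\rangle$; $\epsilon$ empty table, juxtaposition concatenation, $\mathbf{diverge}=\mathit{abort}()$ with $\mathit{abort}\,\{\mathit{abort}()\}$ included in the table when needed. Stuttering: $\tilde\sigma$ is obtained from a trace $\sigma$ by replacing every maximal block $s\cdot s\cdots s$ of repeated consecutive equal states by a single $s$; $\widetilde{A}=\{\tilde\sigma:\sigma\in A\}$. -}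

module Defs where

open import Data.Nat using (ℕ; _≡ᵇ_)
open import Data.Integer using (ℤ) renaming (_+_ to _+ℤ_; _-_ to _-ℤ_; _*_ to _*ℤ_; _≤ᵇ_ to _≤ℤᵇ_)
import Data.Integer as ℤ
open import Data.Bool using (Bool; true; false; if_then_else_; not; _∧_)
open import Data.List using (List; []; _∷_; _++_)
open import Data.List.NonEmpty using (List⁺; _∷_; _⁺++_; last) renaming (head to hd)
import Data.List.NonEmpty as L⁺
open import Data.List.Membership.Propositional using (_∈_)
open import Data.List.Relation.Unary.Unique.Propositional using (Unique)
open import Data.Product using (_×_; _,_; ∃; ∃-syntax; proj₁; proj₂)
open import Relation.Binary.PropositionalEquality using (_≡_; _≢_)
open import Relation.Nullary using (¬_)

PVar : Set
PVar = ℕ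

State : Set
State = PVar → ℤ

_≈ₛ_ : State → State → Set
s ≈ₛ t = ∀ x → s x ≡ t x

_[_↦_] : State → PVar → ℤ → State
(s [ x ↦ v ]) y = if y ≡ᵇ x then v else s y

data AExp : Set where
  num  : ℤ → AExp
  var  : PVar → AExp
  _⊕_  : AExp → AExp → AExp
  _⊖_  : AExp → AExp → AExp
  _⊗_  : AExp → AExp → AExp

𝒜⟦_⟧ : AExp → State → ℤ
𝒜⟦ num n ⟧ s = n
𝒜⟦ var x ⟧ s = s x
𝒜⟦ a ⊕ b ⟧ s = 𝒜⟦ a ⟧ s +ℤ 𝒜⟦ b ⟧ s
𝒜⟦ a ⊖ b ⟧ s = 𝒜⟦ a ⟧ s -ℤ 𝒜⟦ b ⟧ s
𝒜⟦ a ⊗ b ⟧ s = 𝒜⟦ a ⟧ s *ℤ 𝒜⟦ b ⟧ s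

data BExp : Set where
  btrue bfalse : BExp
  _≐_ _≼_      : AExp → AExp → BExp
  bnot         : BExp → BExp
  _&_          : BExp → BExp → BExp

ℬ⟦_⟧ : BExp → State → Bool
ℬ⟦ btrue ⟧ s = true
ℬ⟦ bfalse ⟧ s = false
ℬ⟦ a ≐ b ⟧ s = (𝒜⟦ a ⟧ s ≤ℤᵇ 𝒜⟦ b ⟧ s) ∧ (𝒜⟦ b ⟧ s ≤ℤᵇ 𝒜⟦ a ⟧ s)
ℬ⟦ a ≼ b ⟧ s = 𝒜⟦ a ⟧ s ≤ℤᵇ 𝒜⟦ b ⟧ s
ℬ⟦ bnot b ⟧ s = not (ℬ⟦ b ⟧ s)
ℬ⟦ b & c ⟧ s = ℬ⟦ b ⟧ s ∧ ℬ⟦ c ⟧ s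

Trace : Set
Trace = List⁺ State

TraceSet : Set₁
TraceSet = Trace → Set

-- chop:  A ⌢ B = { σ_A · s · σ_B : σ_A · s ∈ A , s · σ_B ∈ B }
-- (α ⁺++ tail β glues α and β, sharing last α = head β)

RVar : Set
RVar = ℕ

data PName : Set where
  m   : RVar → PName
  abort : PName

data Stmt : Set where
  skip   : Stmt
  _≔_    : PVar → AExp → Stmt
  _⨾_    : Stmt → Stmt → Stmt
  ifᵇ_then_else_ : BExp → Stmt → Stmt → Stmt
  if*_else_ : Stmt → Stmt → Stmt
  call   : PName → Stmt

Table : Set
Table = List (PName × Stmt)

-- The procedure
-- environment ρ₀ (least fixed point of ρ ↦ (♯ S_tr⟦S_m⟧_ρ)_m) is
-- rendered as the inductive (= least) definition: a call m() has the
-- traces of ♯ S_tr⟦S_m⟧.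
data Str (T : Table) : Stmt → Trace → Set where
  skip   : ∀ {s} → Str T skip (s ∷ s ∷ [])
  assign : ∀ {s x a} → Str T (x ≔ a) (s ∷ (s [ x ↦ 𝒜⟦ a ⟧ s ]) ∷ [])
  seq    : ∀ {S₁ S₂ α β} → Str T S₁ α → Str T S₂ β → last α ≡ hd β →
           Str T (S₁ ⨾ S₂) (α ⁺++ L⁺.tail β)
  ifT    : ∀ {b S₁ S₂ s σ} → ℬ⟦ b ⟧ s ≡ true → Str T S₁ (s ∷ σ) →
           Str T (ifᵇ b then S₁ else S₂) (s ∷ s ∷ σ)
  ifF    : ∀ {b S₁ S₂ s σ} → ℬ⟦ b ⟧ s ≡ false → Str T S₂ (s ∷ σ) →
           Str T (ifᵇ b then S₁ else S₂) (s ∷ s ∷ σ)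
  if*₁   : ∀ {S₁ S₂ s σ} → Str T S₁ (s ∷ σ) → Str T (if* S₁ else S₂) (s ∷ s ∷ σ)
  if*₂   : ∀ {S₁ S₂ s σ} → Str T S₂ (s ∷ σ) → Str T (if* S₁ else S₂) (s ∷ s ∷ σ)
  call   : ∀ {p S s σ} → (p , S) ∈ T → Str T S (s ∷ σ) → Str T (call p) (s ∷ s ∷ σ)

data Formula : Set where
  Id   : Formula
  Sb   : PVar → AExp → Formula
  rv   : RVar → Formula
  _∧ᶠ_ : BExp → Formula → Formula
  _∨ᶠ_ : Formula → Formula → Formula
  _⌢_  : Formula → Formula → Formula
  μ    : RVar → Formula → Formula

FV : Formula → List RVar
FV Id = []
FV (Sb x a) = []
FV (rv X) = X ∷ []
FV (p ∧ᶠ φ) = FV φ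
FV (φ ∨ᶠ ψ) = FV φ ++ FV ψ
FV (φ ⌢ ψ) = FV φ ++ FV ψ
FV (μ X φ) = remove (FV φ)
  where
  remove : List RVar → List RVar
  remove [] = []
  remove (Y ∷ Ys) = if Y ≡ᵇ X then remove Ys else Y ∷ remove Ys

BV : Formula → List RVar
BV Id = []
BV (Sb x a) = []
BV (rv X) = []
BV (p ∧ᶠ φ) = BV φ
BV (φ ∨ᶠ ψ) = BV φ ++ BV ψ
BV (φ ⌢ ψ) = BV φ ++ BV ψ
BV (μ X φ) = X ∷ BV φ

Closed : Formula → Set
Closed φ = FV φ ≡ []

UniquelyNamed : Formula → Set
UniquelyNamed φ = Unique (BV φ)

-- Valuations of recursion variables arise only from
-- enclosing μ-binders; they are represented by closures (X ↦ body, env),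
-- and ⟦μX.φ⟧ (least fixed point) is rendered as the inductive (= least)
-- definition.
data Env : Set where
  ε     : Env
  bind  : RVar → Formula → Env → Env → Env   -- bind X φ E_φ E : X ↦ ⟦μX.φ⟧_{E_φ}, rest E

data Lookup : Env → RVar → Formula → Env → Set where
  here  : ∀ {X φ Eφ E} → Lookup (bind X φ Eφ E) X φ Eφ
  there : ∀ {X Y φ Eφ ψ Eψ E} → X ≢ Y → Lookup E X φ Eφ →
          Lookup (bind Y ψ Eψ E) X φ Eφ

data ⟦_⟧_∋_ : Formula → Env → Trace → Set where
  id   : ∀ {E s} → ⟦ Id ⟧ E ∋ (s ∷ s ∷ [])
  sb   : ∀ {E s x a} → ⟦ Sb x a ⟧ E ∋ (s ∷ (s [ x ↦ 𝒜⟦ a ⟧ s ]) ∷ [])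
  rv   : ∀ {E X φ Eφ σ} → Lookup E X φ Eφ → ⟦ μ X φ ⟧ Eφ ∋ σ → ⟦ rv X ⟧ E ∋ σ
  and  : ∀ {E p φ σ} → ℬ⟦ p ⟧ (L⁺.head σ) ≡ true → ⟦ φ ⟧ E ∋ σ → ⟦ p ∧ᶠ φ ⟧ E ∋ σ
  orl  : ∀ {E φ ψ σ} → ⟦ φ ⟧ E ∋ σ → ⟦ φ ∨ᶠ ψ ⟧ E ∋ σ
  orr  : ∀ {E φ ψ σ} → ⟦ ψ ⟧ E ∋ σ → ⟦ φ ∨ᶠ ψ ⟧ E ∋ σ
  chop : ∀ {E φ ψ α β} → ⟦ φ ⟧ E ∋ α → ⟦ ψ ⟧ E ∋ β → last α ≡ hd β →
         ⟦ φ ⌢ ψ ⟧ E ∋ (α ⁺++ L⁺.tail β)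
  mu   : ∀ {E X φ σ} → ⟦ φ ⟧ (bind X φ E E) ∋ σ → ⟦ μ X φ ⟧ E ∋ σ

⟦_⟧ : Formula → TraceSet
⟦ φ ⟧ σ = ⟦ φ ⟧ ε ∋ σ

diverge : Stmt
diverge = call abort

can : Formula → Stmt × Table
can Id = skip , []
can (Sb x a) = (x ≔ a) , []
can (p ∧ᶠ φ) = (ifᵇ p then proj₁ (can φ) else diverge) , proj₂ (can φ)
can (φ ∨ᶠ ψ) = (if* proj₁ (can φ) else proj₁ (can ψ)) , (proj₂ (can φ) ++ proj₂ (can ψ))
can (φ ⌢ ψ) = (proj₁ (can φ) ⨾ proj₁ (can ψ)) , (proj₂ (can φ) ++ proj₂ (can ψ))
can (μ X φ) = call (m X) , (proj₂ (can φ) ++ ((m X , proj₁ (can φ)) ∷ []))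
can (rv X) = call (m X) , []

S[_] : Formula → Stmt
S[ φ ] = proj₁ (can φ)

T[_] : Formula → Table
T[ φ ] = proj₂ (can φ) ++ ((abort , call abort) ∷ [])

-- Stuttering:  Collapse σ τ  iff  τ = σ̃  (every maximal block of
-- consecutive equal states replaced by a single state)

data Collapse : Trace → Trace → Set where
  one  : ∀ {s} → Collapse (s ∷ []) (s ∷ [])
  dup  : ∀ {s t σ τ} → s ≈ₛ t → Collapse (s ∷ σ) τ → Collapse (s ∷ t ∷ σ) τ
  step : ∀ {s t σ τ} → ¬ (s ≈ₛ t) → Collapse (t ∷ σ) τ →
         Collapse (s ∷ t ∷ σ) (s ∷ L⁺.toList τ)

Stutter : TraceSet → TraceSet
Stutter A τ = ∃[ σ ] (A σ × Collapse σ τ)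

_≐ₜ_ : TraceSet → TraceSet → Set
A ≐ₜ B = ∀ τ → (A τ → B τ) × (B τ → A τ)

-- The canonical program builds its traces exactly as the formula does,
-- except that a conditional, a choice and a procedure call each repeat their
-- initial state (the ♯ in their semantics).  Hence, by induction along the
-- derivations, every program trace is a formula trace with some states
-- repeated in place, and every formula trace becomes a program trace after
-- such repetitions; stuttering erases exactly these repetitions.  Unique
-- naming makes the declaration of each m_X unique, so a call m_X() runs the
-- body of μX; closedness guarantees that each free X in a subformula is bound
-- by an enclosing μX; and the branch diverge of p ∧ φ has no traces at all.
module Submission where

open import Defs
open import Data.Bool using (true; false; if_then_else_; T)
open import Data.Empty using (⊥-elim)
open import Data.List using (List; []; _∷_; _++_; _∷ʳ_; [_]; map; initLast; _∷ʳ′_)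
open import Data.List.Properties using (map-++)
open import Data.List.NonEmpty using (List⁺; _∷_; _⁺++_; last) renaming (head to hd; tail to tl)
open import Data.List.Membership.Propositional using (_∈_; _∉_)
open import Data.List.Membership.Propositional.Properties using (∈-++⁺ˡ; ∈-++⁺ʳ; ∈-++⁻; ∈-map⁺; ∈-map⁻)
open import Data.List.Relation.Unary.Any using (here; there)
import Data.List.Relation.Unary.All as All
open import Data.List.Relation.Unary.AllPairs using ([]; _∷_)
open import Data.List.Relation.Unary.Unique.Propositional using (Unique)
import Data.List.Relation.Unary.Unique.Propositional.Properties as Unique
open import Data.List.Relation.Binary.Permutation.Propositional
  using (_↭_; ↭-refl; ↭-sym; ↭⇒↭ₛ; module PermutationReasoning)
import Data.List.Relation.Binary.Permutation.Propositional.Properties as ↭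
open import Data.List.Relation.Binary.Permutation.Setoid.Properties using (Unique-resp-↭)
open import Data.Nat using (_≟_; _≡ᵇ_)
open import Data.Nat.Properties using (≡ᵇ⇒≡)
open import Data.Product using (_×_; _,_; ∃-syntax; proj₁; proj₂)
open import Data.Sum using (inj₁; inj₂)
open import Function using (_∘_)
open import Relation.Nullary using (¬_; yes; no)
open import Relation.Unary using (_⊆_)
open import Relation.Binary.PropositionalEquality
  using (_≡_; _≢_; refl; sym; trans; subst; setoid)

module _ {A : Set} where

  lastFrom : A → List A → A
  lastFrom a []       = a
  lastFrom a (b ∷ xs) = lastFrom b xs

  last-∷ : ∀ (a b : A) xs → last (a ∷ b ∷ xs) ≡ last (b ∷ xs)
  last-∷ a b xs with initLast xs
  ... | []      = refl
  ... | _ ∷ʳ′ _ = refl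

  last≡lastFrom : ∀ (a : A) xs → last (a ∷ xs) ≡ lastFrom a xs
  last≡lastFrom a []       = refl
  last≡lastFrom a (b ∷ xs) = trans (last-∷ a b xs) (last≡lastFrom b xs)

  -- Stretch a xs ys: ys is xs with some states repeated in place, where
  -- a is the state preceding both lists.
  data Stretch : A → List A → List A → Set where
    []     : ∀ {a} → Stretch a [] []
    keep   : ∀ {a b xs ys} → Stretch b xs ys → Stretch a (b ∷ xs) (b ∷ ys)
    repeat : ∀ {a xs ys} → Stretch a xs ys → Stretch a xs (a ∷ ys)

  Stretch-refl : ∀ a xs → Stretch a xs xs
  Stretch-refl a []       = []
  Stretch-refl a (b ∷ xs) = keep (Stretch-refl b xs)

  Stretch-lastFrom : ∀ {a xs ys} → Stretch a xs ys → lastFrom a xs ≡ lastFrom a ys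
  Stretch-lastFrom []         = refl
  Stretch-lastFrom (keep s)   = Stretch-lastFrom s
  Stretch-lastFrom (repeat s) = Stretch-lastFrom s

  Stretch-++ : ∀ {a b xs ys zs ws} → Stretch a xs ys → lastFrom a xs ≡ b →
               Stretch b zs ws → Stretch a (xs ++ zs) (ys ++ ws)
  Stretch-++ []         refl t = t
  Stretch-++ (keep s)   eq   t = keep (Stretch-++ s eq t)
  Stretch-++ (repeat s) eq   t = repeat (Stretch-++ s eq t)

  infix 4 _⊑_

  data _⊑_ : List⁺ A → List⁺ A → Set where
    stretch : ∀ {a xs ys} → Stretch a xs ys → a ∷ xs ⊑ a ∷ ys

  ⊑-refl : ∀ σ → σ ⊑ σ
  ⊑-refl (a ∷ xs) = stretch (Stretch-refl a xs)

  ⊑-last : ∀ {σ ρ} → σ ⊑ ρ → last σ ≡ last ρ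
  ⊑-last (stretch {a} {xs} {ys} s) =
    trans (last≡lastFrom a xs) (trans (Stretch-lastFrom s) (sym (last≡lastFrom a ys)))

  ⊑-⁺++ : ∀ {α α′ β β′} → α ⊑ α′ → β ⊑ β′ → last α ≡ hd β →
          α ⁺++ tl β ⊑ α′ ⁺++ tl β′
  ⊑-⁺++ (stretch {a} {xs} s) (stretch t) eq =
    stretch (Stretch-++ s (trans (sym (last≡lastFrom a xs)) eq) t)

≈ₛ-refl : ∀ {s} → s ≈ₛ s
≈ₛ-refl _ = refl

-- Generalised to a ≈ₛ b because dup drops the second of two equal states:
-- the collapsed trace continues from a while the stretch continues from b.
Collapse-stretch⁺ : ∀ {a b xs ys τ} → Stretch b xs ys → a ≈ₛ b →
                    Collapse (a ∷ xs) τ → Collapse (a ∷ ys) τ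
Collapse-stretch⁺ []         a≈b c            = c
Collapse-stretch⁺ (repeat s) a≈b c            = dup a≈b (Collapse-stretch⁺ s a≈b c)
Collapse-stretch⁺ (keep s)   a≈b (dup a≈c c)  = dup a≈c (Collapse-stretch⁺ s a≈c c)
Collapse-stretch⁺ (keep s)   a≈b (step a≉c c) = step a≉c (Collapse-stretch⁺ s ≈ₛ-refl c)

Collapse-stretch⁻ : ∀ {a b xs ys τ} → Stretch b xs ys → a ≈ₛ b →
                    Collapse (a ∷ ys) τ → Collapse (a ∷ xs) τ
Collapse-stretch⁻ []         a≈b c            = c
Collapse-stretch⁻ (repeat s) a≈b (dup _ c)    = Collapse-stretch⁻ s a≈b c
Collapse-stretch⁻ (repeat s) a≈b (step a≉b c) = ⊥-elim (a≉b a≈b)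
Collapse-stretch⁻ (keep s)   a≈b (dup a≈c c)  = dup a≈c (Collapse-stretch⁻ s a≈c c)
Collapse-stretch⁻ (keep s)   a≈b (step a≉c c) = step a≉c (Collapse-stretch⁻ s ≈ₛ-refl c)

Collapse-⊑⁺ : ∀ {σ ρ τ} → σ ⊑ ρ → Collapse σ τ → Collapse ρ τ
Collapse-⊑⁺ (stretch s) = Collapse-stretch⁺ s ≈ₛ-refl

Collapse-⊑⁻ : ∀ {σ ρ τ} → σ ⊑ ρ → Collapse ρ τ → Collapse σ τ
Collapse-⊑⁻ (stretch s) = Collapse-stretch⁻ s ≈ₛ-refl

↑_ ↓_ : TraceSet → TraceSet
(↑ A) ρ = ∃[ σ ] A σ × σ ⊑ ρ
(↓ A) σ = ∃[ ρ ] A ρ × σ ⊑ ρ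

Stutter-mono-↑ : ∀ {A B} → A ⊆ ↑ B → Stutter A ⊆ Stutter B
Stutter-mono-↑ A⊆↑B (ρ , ρ∈A , ρ↝τ) =
  let σ , σ∈B , σ⊑ρ = A⊆↑B ρ∈A in σ , σ∈B , Collapse-⊑⁻ σ⊑ρ ρ↝τ

Stutter-mono-↓ : ∀ {A B} → B ⊆ ↓ A → Stutter B ⊆ Stutter A
Stutter-mono-↓ B⊆↓A (σ , σ∈B , σ↝τ) =
  let ρ , ρ∈A , σ⊑ρ = B⊆↓A σ∈B in ρ , ρ∈A , Collapse-⊑⁺ σ⊑ρ σ↝τ

Stutter-cong : ∀ {A B} → A ⊆ ↑ B → B ⊆ ↓ A → Stutter A ≐ₜ Stutter B
Stutter-cong A⊆↑B B⊆↓A τ = Stutter-mono-↑ A⊆↑B , Stutter-mono-↓ B⊆↓A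

↑-♯ : ∀ {A B : TraceSet} {a ρs} → (∀ {xs} → A (a ∷ xs) → B (a ∷ xs)) →
      (↑ A) (a ∷ ρs) → (↑ B) (a ∷ a ∷ ρs)
↑-♯ A⊆B (_ , σ∈A , stretch s) = _ , A⊆B σ∈A , stretch (repeat s)

↓-♯ : ∀ {A B : TraceSet} {σ} → (∀ {ρs} → A (hd σ ∷ ρs) → B (hd σ ∷ hd σ ∷ ρs)) →
      (↓ A) σ → (↓ B) σ
↓-♯ ♯A⊆B (_ , ρ∈A , stretch s) = _ , ♯A⊆B ρ∈A , stretch (repeat s)

Chop-closed : TraceSet → TraceSet → TraceSet → Set
Chop-closed A B C = ∀ {α β} → A α → B β → last α ≡ hd β → C (α ⁺++ tl β)

↑-⁺++ : ∀ {A B C : TraceSet} → Chop-closed A B C → Chop-closed (↑ A) (↑ B) (↑ C)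
↑-⁺++ glue (_ , α∈A , α⊑α′) (_ , β∈B , β⊑β′@(stretch _)) eq =
  _ , glue α∈A β∈B (trans (⊑-last α⊑α′) eq) , ⊑-⁺++ α⊑α′ β⊑β′ (trans (⊑-last α⊑α′) eq)

↓-⁺++ : ∀ {A B C : TraceSet} → Chop-closed A B C → Chop-closed (↓ A) (↓ B) (↓ C)
↓-⁺++ glue (_ , α′∈A , α⊑α′) (_ , β′∈B , β⊑β′@(stretch _)) eq =
  _ , glue α′∈A β′∈B (trans (sym (⊑-last α⊑α′)) eq) , ⊑-⁺++ α⊑α′ β⊑β′ eq

functional-on-keys : ∀ {K V : Set} {kvs : List (K × V)} {k v w} →
                     Unique (map proj₁ kvs) → (k , v) ∈ kvs → (k , w) ∈ kvs → v ≡ w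
functional-on-keys _        (here refl) (here refl) = refl
functional-on-keys (k∉ ∷ _) (here refl) (there kw)  = ⊥-elim (All.lookup k∉ (∈-map⁺ proj₁ kw) refl)
functional-on-keys (k∉ ∷ _) (there kv)  (here refl) = ⊥-elim (All.lookup k∉ (∈-map⁺ proj₁ kv) refl)
functional-on-keys (_ ∷ u)  (there kv)  (there kw)  = functional-on-keys u kv kw

tbl : Formula → Table
tbl ψ = proj₂ (can ψ)

declared : Table → List PName
declared = map proj₁

declared-++ : ∀ T U {Xs Ys} → declared T ↭ map m Xs → declared U ↭ map m Ys →
              declared (T ++ U) ↭ map m (Xs ++ Ys)
declared-++ T U {Xs} {Ys} T↭Xs U↭Ys = begin
  declared (T ++ U)            ≡⟨ map-++ proj₁ T U ⟩
  declared T ++ declared U     ↭⟨ ↭.++⁺ T↭Xs U↭Ys ⟩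
  map m Xs ++ map m Ys         ≡⟨ map-++ m Xs Ys ⟨
  map m (Xs ++ Ys)             ∎
  where open PermutationReasoning

declared-can : ∀ ψ → declared (tbl ψ) ↭ map m (BV ψ)
declared-can Id       = ↭-refl
declared-can (Sb x a) = ↭-refl
declared-can (rv X)   = ↭-refl
declared-can (p ∧ᶠ ψ) = declared-can ψ
declared-can (ψ ∨ᶠ χ) = declared-++ (tbl ψ) (tbl χ) (declared-can ψ) (declared-can χ)
declared-can (ψ ⌢ χ)  = declared-++ (tbl ψ) (tbl χ) (declared-can ψ) (declared-can χ)
declared-can (μ X ψ)  = begin
  declared (tbl ψ ++ [ m X , S[ ψ ] ])  ≡⟨ map-++ proj₁ (tbl ψ) _ ⟩
  declared (tbl ψ) ∷ʳ m X               ↭⟨ ↭.∷↭∷ʳ (m X) _ ⟨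
  m X ∷ declared (tbl ψ)                <⟨ declared-can ψ ⟩
  m X ∷ map m (BV ψ)                    ∎
  where open PermutationReasoning

abort∉can : ∀ ψ → abort ∉ declared (tbl ψ)
abort∉can ψ abort∈ with ∈-map⁻ m (↭.∈-resp-↭ (declared-can ψ) abort∈)
... | _ , _ , ()

m-injective : ∀ {X Y} → m X ≡ m Y → X ≡ Y
m-injective refl = refl

T-declared-unique : ∀ ψ → UniquelyNamed ψ → Unique (declared T[ ψ ])
T-declared-unique ψ u = Unique-resp-↭ (setoid PName) (↭⇒↭ₛ (↭-sym T↭)) unique
  where
  T↭ : declared T[ ψ ] ↭ map m (BV ψ) ++ [ abort ]
  T↭ = begin
    declared T[ ψ ]                    ≡⟨ map-++ proj₁ (tbl ψ) _ ⟩
    declared (tbl ψ) ++ [ abort ]      ↭⟨ ↭.++⁺ʳ [ abort ] (declared-can ψ) ⟩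
    map m (BV ψ) ++ [ abort ]          ∎
    where open PermutationReasoning
  unique : Unique (map m (BV ψ) ++ [ abort ])
  unique = Unique.++⁺ (Unique.map⁺ m-injective u) (All.[] ∷ [])
             λ { (abort∈ , here refl) → abort∉can ψ (↭.∈-resp-↭ (↭-sym (declared-can ψ)) abort∈) }

T-functional : ∀ ψ → UniquelyNamed ψ → ∀ {p S₁ S₂} →
               (p , S₁) ∈ T[ ψ ] → (p , S₂) ∈ T[ ψ ] → S₁ ≡ S₂
T-functional ψ u = functional-on-keys (T-declared-unique ψ u)

abort-declaration : ∀ ψ {S} → (abort , S) ∈ T[ ψ ] → S ≡ diverge
abort-declaration ψ abort∈T with ∈-++⁻ (tbl ψ) abort∈T
... | inj₁ abort∈can   = ⊥-elim (abort∉can ψ (∈-map⁺ proj₁ abort∈can))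
... | inj₂ (here refl) = refl

diverge-empty : ∀ ψ {σ} → ¬ Str T[ ψ ] diverge σ
diverge-empty ψ (call abort∈T run) with refl ← abort-declaration ψ abort∈T = diverge-empty ψ run

∈-remove : ∀ {X Y} (remove : List RVar → List RVar) →
           (∀ Z Zs → remove (Z ∷ Zs) ≡ (if Z ≡ᵇ Y then remove Zs else Z ∷ remove Zs)) →
           X ≢ Y → ∀ {Zs} → X ∈ Zs → X ∈ remove Zs
∈-remove {Y = Y} remove remove-∷ X≢Y {Z ∷ Zs} X∈ rewrite remove-∷ Z Zs with Z ≡ᵇ Y in Z≡ᵇY | X∈
... | true  | here refl = ⊥-elim (X≢Y (≡ᵇ⇒≡ Z Y (subst T (sym Z≡ᵇY) _)))
... | true  | there X∈Zs = ∈-remove remove remove-∷ X≢Y X∈Zs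
... | false | here refl = here refl
... | false | there X∈Zs = there (∈-remove remove remove-∷ X≢Y X∈Zs)

-- FV (μ Y ψ) deletes Y with a where-bound function of FV that cannot be
-- named here; once FV ψ is abstracted, unification recovers it from the goal.
∈-FV-μ : ∀ {X Y} ψ → X ≢ Y → X ∈ FV ψ → X ∈ FV (μ Y ψ)
∈-FV-μ ψ X≢Y with FV ψ | ∈-remove _ (λ _ _ → refl) X≢Y
... | _ | X∈⇒X∈remove = X∈⇒X∈remove

module Canonical (φ : Formula) where

  -- Occurrence ψ E: ψ is a subformula occurrence of φ, and E is the
  -- environment in which ⟦ φ ⟧ ε evaluates it.
  data Occurrence : Formula → Env → Set where
    top     : Occurrence φ ε
    ∧-body  : ∀ {p ψ E} → Occurrence (p ∧ᶠ ψ) E → Occurrence ψ E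
    ∨-left  : ∀ {ψ χ E} → Occurrence (ψ ∨ᶠ χ) E → Occurrence ψ E
    ∨-right : ∀ {ψ χ E} → Occurrence (ψ ∨ᶠ χ) E → Occurrence χ E
    ⌢-left  : ∀ {ψ χ E} → Occurrence (ψ ⌢ χ) E → Occurrence ψ E
    ⌢-right : ∀ {ψ χ E} → Occurrence (ψ ⌢ χ) E → Occurrence χ E
    μ-body  : ∀ {X ψ E} → Occurrence (μ X ψ) E → Occurrence ψ (bind X ψ E E)

  Occurrence-tbl : ∀ {ψ E} → Occurrence ψ E → ∀ {e} → e ∈ tbl ψ → e ∈ tbl φ
  Occurrence-tbl top             = λ e∈ → e∈
  Occurrence-tbl (∧-body o)      = Occurrence-tbl o
  Occurrence-tbl (∨-left o)      = Occurrence-tbl o ∘ ∈-++⁺ˡ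
  Occurrence-tbl (∨-right {ψ} o) = Occurrence-tbl o ∘ ∈-++⁺ʳ (tbl ψ)
  Occurrence-tbl (⌢-left o)      = Occurrence-tbl o ∘ ∈-++⁺ˡ
  Occurrence-tbl (⌢-right {ψ} o) = Occurrence-tbl o ∘ ∈-++⁺ʳ (tbl ψ)
  Occurrence-tbl (μ-body o)      = Occurrence-tbl o ∘ ∈-++⁺ˡ

  μ-declared : ∀ {X χ E} → Occurrence (μ X χ) E → (m X , S[ χ ]) ∈ T[ φ ]
  μ-declared {χ = χ} o = ∈-++⁺ˡ (Occurrence-tbl o (∈-++⁺ʳ (tbl χ) (here refl)))

  Occurrence-lookup : ∀ {ψ E X χ Eχ} → Occurrence ψ E → Lookup E X χ Eχ →
                      Occurrence (μ X χ) Eχ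
  Occurrence-lookup (∧-body o)  lk           = Occurrence-lookup o lk
  Occurrence-lookup (∨-left o)  lk           = Occurrence-lookup o lk
  Occurrence-lookup (∨-right o) lk           = Occurrence-lookup o lk
  Occurrence-lookup (⌢-left o)  lk           = Occurrence-lookup o lk
  Occurrence-lookup (⌢-right o) lk           = Occurrence-lookup o lk
  Occurrence-lookup (μ-body o)  here         = o
  Occurrence-lookup (μ-body o)  (there _ lk) = Occurrence-lookup o lk

  Occurrence-FV : Closed φ → ∀ {ψ E X} → Occurrence ψ E → X ∈ FV ψ →
                  ∃[ χ ] ∃[ Eχ ] Lookup E X χ Eχ
  Occurrence-FV closed top X∈ with () ← subst (_ ∈_) closed X∈
  Occurrence-FV closed (∧-body o)      X∈ = Occurrence-FV closed o X∈
  Occurrence-FV closed (∨-left o)      X∈ = Occurrence-FV closed o (∈-++⁺ˡ X∈)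
  Occurrence-FV closed (∨-right {ψ} o) X∈ = Occurrence-FV closed o (∈-++⁺ʳ (FV ψ) X∈)
  Occurrence-FV closed (⌢-left o)      X∈ = Occurrence-FV closed o (∈-++⁺ˡ X∈)
  Occurrence-FV closed (⌢-right {ψ} o) X∈ = Occurrence-FV closed o (∈-++⁺ʳ (FV ψ) X∈)
  Occurrence-FV closed {X = X} (μ-body {Y} {ψ} {E} o) X∈ with X ≟ Y
  ... | yes refl = ψ , E , here
  ... | no X≢Y   =
    let χ , Eχ , lk = Occurrence-FV closed o (∈-FV-μ ψ X≢Y X∈) in χ , Eχ , there X≢Y lk

  Program : Formula → TraceSet
  Program ψ = Str T[ φ ] S[ ψ ]

  formula⇒program : ∀ {ψ E} → Occurrence ψ E → (⟦ ψ ⟧ E ∋_) ⊆ ↓ Program ψ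
  formula⇒program o id              = _ , skip , ⊑-refl _
  formula⇒program o sb              = _ , assign , ⊑-refl _
  formula⇒program o (rv lk σ∈)      = formula⇒program (Occurrence-lookup o lk) σ∈
  formula⇒program o (and p✓ σ∈)     = ↓-♯ (ifT p✓) (formula⇒program (∧-body o) σ∈)
  formula⇒program o (orl σ∈)        = ↓-♯ if*₁ (formula⇒program (∨-left o) σ∈)
  formula⇒program o (orr σ∈)        = ↓-♯ if*₂ (formula⇒program (∨-right o) σ∈)
  formula⇒program o (chop α∈ β∈ eq) =
    ↓-⁺++ seq (formula⇒program (⌢-left o) α∈) (formula⇒program (⌢-right o) β∈) eq
  formula⇒program o (mu σ∈)         = ↓-♯ (call (μ-declared o)) (formula⇒program (μ-body o) σ∈)

  module _ (closed : Closed φ) (uniquelyNamed : UniquelyNamed φ) where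

    program⇒formula : ∀ ψ {E} → Occurrence ψ E → Program ψ ⊆ ↑ (⟦ ψ ⟧ E ∋_)
    program⇒formula Id       o skip         = _ , id , ⊑-refl _
    program⇒formula (Sb x a) o assign       = _ , sb , ⊑-refl _
    program⇒formula (p ∧ᶠ ψ) o (ifT p✓ ρ∈) = ↑-♯ (and p✓) (program⇒formula ψ (∧-body o) ρ∈)
    program⇒formula (p ∧ᶠ ψ) o (ifF _ ρ∈)  = ⊥-elim (diverge-empty φ ρ∈)
    program⇒formula (ψ ∨ᶠ χ) o (if*₁ ρ∈)   = ↑-♯ orl (program⇒formula ψ (∨-left o) ρ∈)
    program⇒formula (ψ ∨ᶠ χ) o (if*₂ ρ∈)   = ↑-♯ orr (program⇒formula χ (∨-right o) ρ∈)
    program⇒formula (ψ ⌢ χ)  o (seq α∈ β∈ eq) =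
      ↑-⁺++ chop (program⇒formula ψ (⌢-left o) α∈) (program⇒formula χ (⌢-right o) β∈) eq
    program⇒formula (μ X χ) o (call m∈T ρ∈)
      with refl ← T-functional φ uniquelyNamed m∈T (μ-declared o)
      = ↑-♯ mu (program⇒formula χ (μ-body o) ρ∈)
    program⇒formula (rv X) o (call m∈T ρ∈)
      with χ , _ , lk ← Occurrence-FV closed o (here refl)
      with refl ← T-functional φ uniquelyNamed m∈T (μ-declared (Occurrence-lookup o lk))
      = ↑-♯ (rv lk ∘ mu) (program⇒formula χ (μ-body (Occurrence-lookup o lk)) ρ∈)

mainTheorem10 : (φ : Formula) → Closed φ → UniquelyNamed φ →
                Stutter (Str T[ φ ] S[ φ ]) ≐ₜ Stutter ⟦ φ ⟧
mainTheorem10 φ closed uniquelyNamed =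
  Stutter-cong (program⇒formula closed uniquelyNamed φ top) (formula⇒program top)
  where open Canonical φ
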